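{- Let $K$ be a field of characteristic $0$ and let $M$ be a $2\times(n+1)$ multiplicity matrix. Let $\Lambda_0=(0,1)$ and let $\Lambda=(\lambda_1,\lambda_2)$ with $\lambda_1,\lambda_2\in K$, $\lambda_1\neq\lambda_2$. There exists a polynomial $f_0(x)\in K[x]$ such that $M=M_{f_0}(\Lambda_0)$ if and only if there exists a polynomial $f(x)\in K[x]$ such that $M=M_f(\Lambda)$.
   Context: For a polynomial $f$ of degree $n$ and a sequence $\Lambda=(\lambda_1,\ldots,\lambda_m)$ of distinct elements of $K$, the multiplicity matrix $M_f(\Lambda)$ is the $m\times(n+1)$ matrix (rows $i\in\{1,\ldots,m\}$, columns $j\in\{0,\ldots,n\}$) whose $(i,j)$ entry is the multiplicity of $\lambda_i$ as a zero of $f^{(j)}(x)$ (which is $0$ if $f^{(j)}(\lambda_i)\neq0$). An $m\times(n+1)$ multiplicity matrix is a matrix $(\mu_{i,j})$ of nonnegative integers (columns $j=0,\ldots,n$) such that each row satisfies $\mu_{i,n}=0$ and $\mu_{i,j}\ge1\Rightarrow\mu_{i,j+1}=\mu_{i,j}-1$, and $\sum_{i=1}^m\mu_{i,j}\le n-j$ for all $j$. -}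

module Defs where

open import Level using (Level; _⊔_)
open import Algebra.Bundles using (CommutativeRing)
open import Data.Nat as ℕ using (ℕ; zero; suc; _≤_; _∸_)
open import Data.Fin using (Fin; zero; suc; toℕ; fromℕ; inject₁)
open import Data.List using (List; []; _∷_)
open import Data.Product using (Σ; ∃; _×_; _,_)
open import Relation.Nullary using (¬_)
open import Relation.Binary.PropositionalEquality using (_≡_)

record Field (c ℓ : Level) : Set (Level.suc (c ⊔ ℓ)) where
  field
    commutativeRing : CommutativeRing c ℓ
  open CommutativeRing commutativeRing public
  field
    1≉0     : ¬ (1# ≈ 0#)
    inverse : ∀ x → ¬ (x ≈ 0#) → Σ Carrier (λ y → x * y ≈ 1#)

sumFin : ∀ {m} → (Fin m → ℕ) → ℕ
sumFin {zero}  f = 0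
sumFin {suc m} f = f zero ℕ.+ sumFin (λ i → f (suc i))

IsMultiplicityMatrix : ∀ {m} n → (Fin m → Fin (suc n) → ℕ) → Set
IsMultiplicityMatrix {m} n μ =
  (∀ i → μ i (fromℕ n) ≡ 0) ×
  (∀ i (j : Fin n) → 1 ≤ μ i (inject₁ j) → μ i (suc j) ≡ μ i (inject₁ j) ∸ 1) ×
  (∀ (j : Fin (suc n)) → sumFin (λ i → μ i j) ≤ n ∸ toℕ j)

module FieldDefs {c ℓ} (F : Field c ℓ) where
  open Field F

  ι : ℕ → Carrier
  ι zero    = 0#
  ι (suc k) = 1# + ι k

  CharZero : Set ℓ
  CharZero = ∀ k → ¬ (ι (suc k) ≈ 0#)

  -- polynomials as coefficient lists, lowest degree first
  Poly : Set c
  Poly = List Carrier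

  coeff : Poly → ℕ → Carrier
  coeff []      _       = 0#
  coeff (a ∷ p) zero    = a
  coeff (a ∷ p) (suc i) = coeff p i

  -- equality of polynomials (coefficientwise; trailing zeros irrelevant)
  _≈P_ : Poly → Poly → Set ℓ
  p ≈P q = ∀ i → coeff p i ≈ coeff q i

  _+P_ : Poly → Poly → Poly
  []      +P q       = q
  (a ∷ p) +P []      = a ∷ p
  (a ∷ p) +P (b ∷ q) = (a + b) ∷ (p +P q)

  scale : Carrier → Poly → Poly
  scale a []      = []
  scale a (b ∷ q) = (a * b) ∷ scale a q

  _*P_ : Poly → Poly → Poly
  []      *P q = []
  (a ∷ p) *P q = scale a q +P (0# ∷ (p *P q))

  X-_ : Carrier → Poly
  X- λ₀ = (- λ₀) ∷ 1# ∷ []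

  _^P_ : Poly → ℕ → Poly
  p ^P zero  = 1# ∷ []
  p ^P suc k = p *P (p ^P k)

  derivAux : ℕ → Poly → Poly
  derivAux k []      = []
  derivAux k (b ∷ p) = (ι k * b) ∷ derivAux (suc k) p

  deriv : Poly → Poly
  deriv []      = []
  deriv (a ∷ p) = derivAux 1 p

  deriv^ : ℕ → Poly → Poly
  deriv^ zero    p = p
  deriv^ (suc j) p = deriv (deriv^ j p)

  HasDegree : Poly → ℕ → Set ℓ
  HasDegree f n = ¬ (coeff f n ≈ 0#) × (∀ i → n ℕ.< i → coeff f i ≈ 0#)

  Divides : ℕ → Carrier → Poly → Set (c ⊔ ℓ)
  Divides k λ₀ g = ∃ λ h → g ≈P (((X- λ₀) ^P k) *P h)

  -- λ is a zero of g of multiplicity exactly k (k = 0 means g(λ) ≠ 0)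
  Multiplicity : Poly → Carrier → ℕ → Set (c ⊔ ℓ)
  Multiplicity g λ₀ k = Divides k λ₀ g × ¬ Divides (suc k) λ₀ g

  IsMultMatrixOf : ∀ {m n} → Poly → (Fin m → Carrier) → (Fin m → Fin (suc n) → ℕ) → Set (c ⊔ ℓ)
  IsMultMatrixOf f Λ M = ∀ i j → Multiplicity (deriv^ (toℕ j) f) (Λ i) (M i j)

  pair : Carrier → Carrier → Fin 2 → Carrier
  pair a b zero       = a
  pair a b (suc zero) = b

{-# OPTIONS --safe #-}
-- The realisable multiplicity matrices are invariant under an affine substitution
-- f ↦ f(a + b·x) with b a unit. Writing λ = a + b·μ, the substitution turns (x − λ)ᵏ·h into
-- (x − μ)ᵏ·bᵏ·h(a + b·x) and is undone by the inverse substitution, so it carries the exact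
-- multiplicity at λ to the exact multiplicity at μ; by the chain rule it commutes with the j-th
-- derivative up to the unit factor bʲ; and it multiplies the leading coefficient by bⁿ. The
-- substitution x ↦ λ₁ + (λ₂ − λ₁)·x moves (0, 1) to (λ₁, λ₂).
module Submission where

open import Defs
open import Level using (_⊔_)
open import Algebra.Bundles using (CommutativeMonoid)
open import Data.Nat as ℕ using (ℕ; zero; suc; _<_; z≤n; s≤s)
import Data.Nat.Properties as ℕₚ
open import Data.List using ([]; _∷_)
open import Data.Fin using (Fin; zero; suc; toℕ)
open import Data.Product using (Σ; ∃; _×_; _,_; proj₁; proj₂)
open import Function.Bundles using (_⇔_; mk⇔)
open import Relation.Nullary using (¬_)
open import Relation.Binary.Bundles using (Setoid)
import Relation.Binary.PropositionalEquality as ≡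
import Algebra.Properties.CommutativeSemigroup as CommutativeSemigroupProperties
import Relation.Binary.Reasoning.Setoid as SetoidReasoning

module PolynomialArithmetic {c ℓ} (F : Field c ℓ) where
  open Field F hiding (zero)
  open FieldDefs F
  open import Algebra.Properties.Semiring.Exp semiring using (_^_)
  open CommutativeSemigroupProperties *-commutativeSemigroup using () renaming (x∙yz≈y∙xz to *-leftComm)

  module ≈-Reasoning = SetoidReasoning setoid

  -- A record rather than _≈P_ itself, so that p and q can be inferred from a proof of p ≋ q.
  infix 4 _≋_
  record _≋_ (p q : Poly) : Set ℓ where
    constructor coeffwise
    field coeff-≈ : p ≈P q
  open _≋_ public

  ≋-setoid : Setoid c ℓ
  ≋-setoid = record
    { Carrier       = Poly
    ; _≈_           = _≋_
    ; isEquivalence = record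
      { refl  = coeffwise λ _ → refl
      ; sym   = λ p≋q → coeffwise λ i → sym (coeff-≈ p≋q i)
      ; trans = λ p≋q q≋r → coeffwise λ i → trans (coeff-≈ p≋q i) (coeff-≈ q≋r i)
      }
    }

  open Setoid ≋-setoid public using () renaming (refl to ≋-refl; sym to ≋-sym; trans to ≋-trans)
  module ≋-Reasoning = SetoidReasoning ≋-setoid

  ∷-cong : ∀ {a b p q} → a ≈ b → p ≋ q → (a ∷ p) ≋ (b ∷ q)
  ∷-cong a≈b p≋q = coeffwise λ { zero → a≈b ; (suc i) → coeff-≈ p≋q i }

  ∷-injective : ∀ {a b p q} → (a ∷ p) ≋ (b ∷ q) → a ≈ b × p ≋ q
  ∷-injective a∷p≋b∷q = coeff-≈ a∷p≋b∷q zero , coeffwise λ i → coeff-≈ a∷p≋b∷q (suc i)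

  ∷-≋-[] : ∀ {a p} → (a ∷ p) ≋ [] → a ≈ 0# × p ≋ []
  ∷-≋-[] a∷p≋[] = coeff-≈ a∷p≋[] zero , coeffwise λ i → coeff-≈ a∷p≋[] (suc i)

  0∷[]≋[] : (0# ∷ []) ≋ []
  0∷[]≋[] = coeffwise λ { zero → refl ; (suc i) → refl }

  -- Since ≋ ignores trailing zeros, such a recursion respects ≋ as soon as step 0# [] ≋ [].
  module _ (f : Poly → Poly) (step : Carrier → Poly → Poly)
           (f-[] : f [] ≋ []) (f-∷ : ∀ a p → f (a ∷ p) ≋ step a (f p))
           (step-cong : ∀ {a b r s} → a ≈ b → r ≋ s → step a r ≋ step b s)
           (step-0 : step 0# [] ≋ []) where

    private
      ≋[]⇒f≋[] : ∀ {p} → p ≋ [] → f p ≋ []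
      ≋[]⇒f≋[] {[]}    _      = f-[]
      ≋[]⇒f≋[] {a ∷ p} a∷p≋[] =
        let a≈0 , p≋[] = ∷-≋-[] a∷p≋[] in
        ≋-trans (f-∷ a p) (≋-trans (step-cong a≈0 (≋[]⇒f≋[] p≋[])) step-0)

    recursion-cong : ∀ {p q} → p ≋ q → f p ≋ f q
    recursion-cong {[]}    {q}     []≋q     = ≋-trans f-[] (≋-sym (≋[]⇒f≋[] (≋-sym []≋q)))
    recursion-cong {a ∷ p} {[]}    a∷p≋[]   = ≋-trans (≋[]⇒f≋[] a∷p≋[]) (≋-sym f-[])
    recursion-cong {a ∷ p} {b ∷ q} a∷p≋b∷q =
      let a≈b , p≋q = ∷-injective a∷p≋b∷q in
      ≋-trans (f-∷ a p) (≋-trans (step-cong a≈b (recursion-cong p≋q)) (≋-sym (f-∷ b q)))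

  coeff-+P : ∀ p q i → coeff (p +P q) i ≈ coeff p i + coeff q i
  coeff-+P []      q       i       = sym (+-identityˡ _)
  coeff-+P (a ∷ p) []      i       = sym (+-identityʳ _)
  coeff-+P (a ∷ p) (b ∷ q) zero    = refl
  coeff-+P (a ∷ p) (b ∷ q) (suc i) = coeff-+P p q i

  coeff-scale : ∀ a p i → coeff (scale a p) i ≈ a * coeff p i
  coeff-scale a []      i       = sym (zeroʳ a)
  coeff-scale a (b ∷ p) zero    = refl
  coeff-scale a (b ∷ p) (suc i) = coeff-scale a p i

  +P-cong : ∀ {p p′ q q′} → p ≋ p′ → q ≋ q′ → (p +P q) ≋ (p′ +P q′)
  +P-cong {p} {p′} {q} {q′} p≋p′ q≋q′ = coeffwise λ i → begin
    coeff (p +P q) i          ≈⟨ coeff-+P p q i ⟩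
    coeff p i + coeff q i     ≈⟨ +-cong (coeff-≈ p≋p′ i) (coeff-≈ q≋q′ i) ⟩
    coeff p′ i + coeff q′ i   ≈⟨ coeff-+P p′ q′ i ⟨
    coeff (p′ +P q′) i        ∎
    where open ≈-Reasoning

  +P-congˡ : ∀ p {q q′} → q ≋ q′ → (p +P q) ≋ (p +P q′)
  +P-congˡ p = +P-cong ≋-refl

  +P-congʳ : ∀ q {p p′} → p ≋ p′ → (p +P q) ≋ (p′ +P q)
  +P-congʳ q p≋p′ = +P-cong p≋p′ ≋-refl

  +P-comm : ∀ p q → (p +P q) ≋ (q +P p)
  +P-comm p q = coeffwise λ i →
    trans (coeff-+P p q i) (trans (+-comm _ _) (sym (coeff-+P q p i)))

  +P-assoc : ∀ p q r → ((p +P q) +P r) ≋ (p +P (q +P r))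
  +P-assoc p q r = coeffwise λ i → begin
    coeff ((p +P q) +P r) i               ≈⟨ coeff-+P (p +P q) r i ⟩
    coeff (p +P q) i + coeff r i          ≈⟨ +-congʳ (coeff-+P p q i) ⟩
    (coeff p i + coeff q i) + coeff r i   ≈⟨ +-assoc _ _ _ ⟩
    coeff p i + (coeff q i + coeff r i)   ≈⟨ +-congˡ (coeff-+P q r i) ⟨
    coeff p i + coeff (q +P r) i          ≈⟨ coeff-+P p (q +P r) i ⟨
    coeff (p +P (q +P r)) i               ∎
    where open ≈-Reasoning

  +P-identityʳ : ∀ p → (p +P []) ≋ p
  +P-identityʳ p = coeffwise λ i → trans (coeff-+P p [] i) (+-identityʳ _)

  +P-commutativeMonoid : CommutativeMonoid c ℓ
  +P-commutativeMonoid = record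
    { Carrier = Poly
    ; _≈_     = _≋_
    ; _∙_     = _+P_
    ; ε       = []
    ; isCommutativeMonoid = record
      { isMonoid = record
        { isSemigroup = record
          { isMagma = record { isEquivalence = Setoid.isEquivalence ≋-setoid ; ∙-cong = +P-cong }
          ; assoc   = +P-assoc
          }
        ; identity = (λ _ → ≋-refl) , +P-identityʳ
        }
      ; comm = +P-comm
      }
    }

  open CommutativeSemigroupProperties (CommutativeMonoid.commutativeSemigroup +P-commutativeMonoid)
    using () renaming (interchange to +P-interchange; x∙yz≈y∙xz to +P-leftComm)

  0∷-+P : ∀ p q → (0# ∷ (p +P q)) ≋ ((0# ∷ p) +P (0# ∷ q))
  0∷-+P p q = ∷-cong (sym (+-identityˡ 0#)) ≋-refl

  scale-cong : ∀ {a b p q} → a ≈ b → p ≋ q → scale a p ≋ scale b q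
  scale-cong {a} {b} {p} {q} a≈b p≋q = coeffwise λ i →
    trans (coeff-scale a p i) (trans (*-cong a≈b (coeff-≈ p≋q i)) (sym (coeff-scale b q i)))

  scale-distribˡ : ∀ a p q → scale a (p +P q) ≋ (scale a p +P scale a q)
  scale-distribˡ a p q = coeffwise λ i → begin
    coeff (scale a (p +P q)) i                  ≈⟨ coeff-scale a (p +P q) i ⟩
    a * coeff (p +P q) i                        ≈⟨ *-congˡ (coeff-+P p q i) ⟩
    a * (coeff p i + coeff q i)                 ≈⟨ distribˡ a _ _ ⟩
    a * coeff p i + a * coeff q i               ≈⟨ +-cong (coeff-scale a p i) (coeff-scale a q i) ⟨
    coeff (scale a p) i + coeff (scale a q) i   ≈⟨ coeff-+P (scale a p) (scale a q) i ⟨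
    coeff (scale a p +P scale a q) i            ∎
    where open ≈-Reasoning

  scale-distribʳ : ∀ a b p → scale (a + b) p ≋ (scale a p +P scale b p)
  scale-distribʳ a b p = coeffwise λ i → begin
    coeff (scale (a + b) p) i                  ≈⟨ coeff-scale (a + b) p i ⟩
    (a + b) * coeff p i                        ≈⟨ distribʳ _ a b ⟩
    a * coeff p i + b * coeff p i              ≈⟨ +-cong (coeff-scale a p i) (coeff-scale b p i) ⟨
    coeff (scale a p) i + coeff (scale b p) i  ≈⟨ coeff-+P (scale a p) (scale b p) i ⟨
    coeff (scale a p +P scale b p) i           ∎
    where open ≈-Reasoning

  scale-assoc : ∀ a b p → scale (a * b) p ≋ scale a (scale b p)
  scale-assoc a b p = coeffwise λ i → begin
    coeff (scale (a * b) p) i       ≈⟨ coeff-scale (a * b) p i ⟩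
    (a * b) * coeff p i             ≈⟨ *-assoc a b _ ⟩
    a * (b * coeff p i)             ≈⟨ *-congˡ (coeff-scale b p i) ⟨
    a * coeff (scale b p) i         ≈⟨ coeff-scale a (scale b p) i ⟨
    coeff (scale a (scale b p)) i   ∎
    where open ≈-Reasoning

  scale-comm : ∀ a b p → scale a (scale b p) ≋ scale b (scale a p)
  scale-comm a b p = ≋-trans (≋-sym (scale-assoc a b p))
    (≋-trans (scale-cong (*-comm a b) ≋-refl) (scale-assoc b a p))

  scale-identity : ∀ p → scale 1# p ≋ p
  scale-identity p = coeffwise λ i → trans (coeff-scale 1# p i) (*-identityˡ _)

  scale-zero : ∀ p → scale 0# p ≋ []
  scale-zero p = coeffwise λ i → trans (coeff-scale 0# p i) (zeroˡ _)

  scale-0∷ : ∀ a p → scale a (0# ∷ p) ≋ (0# ∷ scale a p)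
  scale-0∷ a p = ∷-cong (zeroʳ a) ≋-refl

  *P-congˡ : ∀ q {p p′} → p ≋ p′ → (p *P q) ≋ (p′ *P q)
  *P-congˡ q = recursion-cong (_*P q) (λ a r → scale a q +P (0# ∷ r))
    ≋-refl (λ _ _ → ≋-refl)
    (λ a≈b r≋s → +P-cong (scale-cong a≈b ≋-refl) (∷-cong refl r≋s))
    (+P-cong (scale-zero q) 0∷[]≋[])

  *P-congʳ : ∀ p {q q′} → q ≋ q′ → (p *P q) ≋ (p *P q′)
  *P-congʳ []      q≋q′ = ≋-refl
  *P-congʳ (a ∷ p) q≋q′ = +P-cong (scale-cong refl q≋q′) (∷-cong refl (*P-congʳ p q≋q′))

  *P-zeroʳ : ∀ p → (p *P []) ≋ []
  *P-zeroʳ []      = ≋-refl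
  *P-zeroʳ (a ∷ p) = ≋-trans (∷-cong refl (*P-zeroʳ p)) 0∷[]≋[]

  0∷-*P : ∀ p q → ((0# ∷ p) *P q) ≋ (0# ∷ (p *P q))
  0∷-*P p q = +P-congʳ _ (scale-zero q)

  const-*P : ∀ a p → ((a ∷ []) *P p) ≋ scale a p
  const-*P a p = ≋-trans (+P-congˡ (scale a p) 0∷[]≋[]) (+P-identityʳ _)

  *P-distribʳ : ∀ p p′ q → ((p +P p′) *P q) ≋ ((p *P q) +P (p′ *P q))
  *P-distribʳ []      p′       q = ≋-refl
  *P-distribʳ (a ∷ p) []       q = ≋-sym (+P-identityʳ _)
  *P-distribʳ (a ∷ p) (a′ ∷ p′) q = begin
    scale (a + a′) q +P (0# ∷ ((p +P p′) *P q))
      ≈⟨ +P-cong (scale-distribʳ a a′ q) (∷-cong refl (*P-distribʳ p p′ q)) ⟩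
    (scale a q +P scale a′ q) +P (0# ∷ ((p *P q) +P (p′ *P q)))
      ≈⟨ +P-congˡ _ (0∷-+P (p *P q) (p′ *P q)) ⟩
    (scale a q +P scale a′ q) +P ((0# ∷ (p *P q)) +P (0# ∷ (p′ *P q)))
      ≈⟨ +P-interchange (scale a q) (scale a′ q) (0# ∷ (p *P q)) (0# ∷ (p′ *P q)) ⟩
    ((a ∷ p) *P q) +P ((a′ ∷ p′) *P q)
      ∎
    where open ≋-Reasoning

  *P-distribˡ : ∀ p q q′ → (p *P (q +P q′)) ≋ ((p *P q) +P (p *P q′))
  *P-distribˡ []      q q′ = ≋-refl
  *P-distribˡ (a ∷ p) q q′ = begin
    scale a (q +P q′) +P (0# ∷ (p *P (q +P q′)))
      ≈⟨ +P-cong (scale-distribˡ a q q′) (∷-cong refl (*P-distribˡ p q q′)) ⟩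
    (scale a q +P scale a q′) +P (0# ∷ ((p *P q) +P (p *P q′)))
      ≈⟨ +P-congˡ _ (0∷-+P (p *P q) (p *P q′)) ⟩
    (scale a q +P scale a q′) +P ((0# ∷ (p *P q)) +P (0# ∷ (p *P q′)))
      ≈⟨ +P-interchange (scale a q) (scale a q′) (0# ∷ (p *P q)) (0# ∷ (p *P q′)) ⟩
    ((a ∷ p) *P q) +P ((a ∷ p) *P q′)
      ∎
    where open ≋-Reasoning

  scale-*Pˡ : ∀ b p q → scale b (p *P q) ≋ (scale b p *P q)
  scale-*Pˡ b []      q = ≋-refl
  scale-*Pˡ b (a ∷ p) q = ≋-trans (scale-distribˡ b (scale a q) (0# ∷ (p *P q)))
    (+P-cong (≋-sym (scale-assoc b a q)) (≋-trans (scale-0∷ b (p *P q)) (∷-cong refl (scale-*Pˡ b p q))))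

  scale-*Pʳ : ∀ b p q → scale b (p *P q) ≋ (p *P scale b q)
  scale-*Pʳ b []      q = ≋-refl
  scale-*Pʳ b (a ∷ p) q = ≋-trans (scale-distribˡ b (scale a q) (0# ∷ (p *P q)))
    (+P-cong (scale-comm b a q) (≋-trans (scale-0∷ b (p *P q)) (∷-cong refl (scale-*Pʳ b p q))))

  *P-assoc : ∀ p q r → ((p *P q) *P r) ≋ (p *P (q *P r))
  *P-assoc []      q r = ≋-refl
  *P-assoc (a ∷ p) q r = ≋-trans (*P-distribʳ (scale a q) (0# ∷ (p *P q)) r)
    (+P-cong (≋-sym (scale-*Pˡ a q r)) (≋-trans (0∷-*P (p *P q) r) (∷-cong refl (*P-assoc p q r))))

  *P-∷ʳ : ∀ p b q → (p *P (b ∷ q)) ≋ (scale b p +P (0# ∷ (p *P q)))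
  *P-∷ʳ []      b q = ≋-sym 0∷[]≋[]
  *P-∷ʳ (a ∷ p) b q = ∷-cong (+-congʳ (*-comm a b))
    (≋-trans (+P-congˡ (scale a q) (*P-∷ʳ p b q)) (+P-leftComm (scale a q) (scale b p) (0# ∷ (p *P q))))

  *P-comm : ∀ p q → (p *P q) ≋ (q *P p)
  *P-comm []      q = ≋-sym (*P-zeroʳ q)
  *P-comm (a ∷ p) q = ≋-trans (+P-congˡ (scale a q) (∷-cong refl (*P-comm p q))) (≋-sym (*P-∷ʳ q a p))

  *P-leftComm : ∀ p q r → (p *P (q *P r)) ≋ (q *P (p *P r))
  *P-leftComm p q r = ≋-trans (≋-sym (*P-assoc p q r))
    (≋-trans (*P-congˡ r (*P-comm p q)) (*P-assoc q p r))

  ^P-cong : ∀ {p q} k → p ≋ q → (p ^P k) ≋ (q ^P k)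
  ^P-cong {p} {q} zero    p≋q = ≋-refl
  ^P-cong {p} {q} (suc k) p≋q = ≋-trans (*P-congˡ (p ^P k) p≋q) (*P-congʳ q (^P-cong k p≋q))

  scale-^P : ∀ b p k → (scale b p ^P k) ≋ scale (b ^ k) (p ^P k)
  scale-^P b p zero    = ∷-cong (sym (*-identityˡ 1#)) ≋-refl
  scale-^P b p (suc k) = begin
    scale b p *P (scale b p ^P k)              ≈⟨ *P-congʳ (scale b p) (scale-^P b p k) ⟩
    scale b p *P scale (b ^ k) (p ^P k)        ≈⟨ scale-*Pˡ b p _ ⟨
    scale b (p *P scale (b ^ k) (p ^P k))      ≈⟨ scale-cong refl (scale-*Pʳ (b ^ k) p _) ⟨
    scale b (scale (b ^ k) (p *P (p ^P k)))    ≈⟨ scale-assoc b (b ^ k) _ ⟨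
    scale (b ^ suc k) (p ^P suc k)             ∎
    where open ≋-Reasoning

  _∘P_ : Poly → Poly → Poly
  []      ∘P q = []
  (a ∷ p) ∘P q = (a ∷ []) +P (q *P (p ∘P q))

  ∘P-congˡ : ∀ q {p p′} → p ≋ p′ → (p ∘P q) ≋ (p′ ∘P q)
  ∘P-congˡ q = recursion-cong (_∘P q) (λ a r → (a ∷ []) +P (q *P r))
    ≋-refl (λ _ _ → ≋-refl)
    (λ a≈b r≋s → +P-cong (∷-cong a≈b ≋-refl) (*P-congʳ q r≋s))
    (+P-cong 0∷[]≋[] (*P-zeroʳ q))

  ∘P-congʳ : ∀ p {q q′} → q ≋ q′ → (p ∘P q) ≋ (p ∘P q′)
  ∘P-congʳ []      q≋q′ = ≋-refl
  ∘P-congʳ (a ∷ p) {q} {q′} q≋q′ =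
    +P-congˡ (a ∷ []) (≋-trans (*P-congˡ (p ∘P q) q≋q′) (*P-congʳ q′ (∘P-congʳ p q≋q′)))

  ∘P-+P : ∀ p p′ q → ((p +P p′) ∘P q) ≋ ((p ∘P q) +P (p′ ∘P q))
  ∘P-+P []      p′       q = ≋-refl
  ∘P-+P (a ∷ p) []       q = ≋-sym (+P-identityʳ _)
  ∘P-+P (a ∷ p) (a′ ∷ p′) q = begin
    ((a + a′) ∷ []) +P (q *P ((p +P p′) ∘P q))
      ≈⟨ +P-congˡ _ (*P-congʳ q (∘P-+P p p′ q)) ⟩
    ((a ∷ []) +P (a′ ∷ [])) +P (q *P ((p ∘P q) +P (p′ ∘P q)))
      ≈⟨ +P-congˡ _ (*P-distribˡ q (p ∘P q) (p′ ∘P q)) ⟩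
    ((a ∷ []) +P (a′ ∷ [])) +P ((q *P (p ∘P q)) +P (q *P (p′ ∘P q)))
      ≈⟨ +P-interchange (a ∷ []) (a′ ∷ []) (q *P (p ∘P q)) (q *P (p′ ∘P q)) ⟩
    ((a ∷ p) ∘P q) +P ((a′ ∷ p′) ∘P q)
      ∎
    where open ≋-Reasoning

  ∘P-scale : ∀ b p q → (scale b p ∘P q) ≋ scale b (p ∘P q)
  ∘P-scale b []      q = ≋-refl
  ∘P-scale b (a ∷ p) q = ≋-trans
    (+P-congˡ _ (≋-trans (*P-congʳ q (∘P-scale b p q)) (≋-sym (scale-*Pʳ b q (p ∘P q)))))
    (≋-sym (scale-distribˡ b (a ∷ []) (q *P (p ∘P q))))

  ∘P-const : ∀ a q → ((a ∷ []) ∘P q) ≋ (a ∷ [])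
  ∘P-const a q = ≋-trans (+P-congˡ _ (*P-zeroʳ q)) (+P-identityʳ _)

  ∘P-0∷ : ∀ p q → ((0# ∷ p) ∘P q) ≋ (q *P (p ∘P q))
  ∘P-0∷ p q = +P-congʳ _ 0∷[]≋[]

  ∘P-*P : ∀ p p′ q → ((p *P p′) ∘P q) ≋ ((p ∘P q) *P (p′ ∘P q))
  ∘P-*P []      p′ q = ≋-refl
  ∘P-*P (a ∷ p) p′ q = begin
    (scale a p′ +P (0# ∷ (p *P p′))) ∘P q
      ≈⟨ ∘P-+P (scale a p′) (0# ∷ (p *P p′)) q ⟩
    (scale a p′ ∘P q) +P ((0# ∷ (p *P p′)) ∘P q)
      ≈⟨ +P-cong (∘P-scale a p′ q) (∘P-0∷ (p *P p′) q) ⟩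
    scale a (p′ ∘P q) +P (q *P ((p *P p′) ∘P q))
      ≈⟨ +P-cong (≋-sym (const-*P a (p′ ∘P q))) (*P-congʳ q (∘P-*P p p′ q)) ⟩
    ((a ∷ []) *P (p′ ∘P q)) +P (q *P ((p ∘P q) *P (p′ ∘P q)))
      ≈⟨ +P-congˡ _ (*P-assoc q (p ∘P q) (p′ ∘P q)) ⟨
    ((a ∷ []) *P (p′ ∘P q)) +P ((q *P (p ∘P q)) *P (p′ ∘P q))
      ≈⟨ *P-distribʳ (a ∷ []) (q *P (p ∘P q)) (p′ ∘P q) ⟨
    ((a ∷ p) ∘P q) *P (p′ ∘P q)
      ∎
    where open ≋-Reasoning

  ∘P-^P : ∀ p k q → ((p ^P k) ∘P q) ≋ ((p ∘P q) ^P k)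
  ∘P-^P p zero    q = ∘P-const 1# q
  ∘P-^P p (suc k) q = ≋-trans (∘P-*P p (p ^P k) q) (*P-congʳ (p ∘P q) (∘P-^P p k q))

  ∘P-assoc : ∀ p q r → ((p ∘P q) ∘P r) ≋ (p ∘P (q ∘P r))
  ∘P-assoc []      q r = ≋-refl
  ∘P-assoc (a ∷ p) q r = ≋-trans (∘P-+P (a ∷ []) (q *P (p ∘P q)) r)
    (+P-cong (∘P-const a r) (≋-trans (∘P-*P q (p ∘P q) r) (*P-congʳ (q ∘P r) (∘P-assoc p q r))))

  X : Poly
  X = 0# ∷ 1# ∷ []

  ∘P-X : ∀ p → (p ∘P X) ≋ p
  ∘P-X []      = ≋-refl
  ∘P-X (a ∷ p) = ≋-trans (+P-congˡ (a ∷ []) X*P) (∷-cong (+-identityʳ a) (∘P-X p))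
    where
    X*P : (X *P (p ∘P X)) ≋ (0# ∷ (p ∘P X))
    X*P = +P-cong (scale-zero _) (∷-cong refl (≋-trans (const-*P 1# _) (scale-identity _)))

  linear-∘P : ∀ a b q → ((a ∷ b ∷ []) ∘P q) ≋ ((a ∷ []) +P scale b q)
  linear-∘P a b q = +P-congˡ (a ∷ [])
    (≋-trans (*P-congʳ q (∘P-const b q)) (≋-trans (*P-comm q (b ∷ [])) (const-*P b q)))

  coeff-derivAux : ∀ k p i → coeff (derivAux k p) i ≈ ι (i ℕ.+ k) * coeff p i
  coeff-derivAux k []      i       = sym (zeroʳ _)
  coeff-derivAux k (b ∷ p) zero    = refl
  coeff-derivAux k (b ∷ p) (suc i) =
    trans (coeff-derivAux (suc k) p i) (*-congʳ (reflexive (≡.cong ι (ℕₚ.+-suc i k))))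

  coeff-deriv : ∀ p i → coeff (deriv p) i ≈ ι (suc i) * coeff p (suc i)
  coeff-deriv []      i = sym (zeroʳ _)
  coeff-deriv (a ∷ p) i = trans (coeff-derivAux 1 p i) (*-congʳ (reflexive (≡.cong ι (ℕₚ.+-comm i 1))))

  deriv-cong : ∀ {p q} → p ≋ q → deriv p ≋ deriv q
  deriv-cong {p} {q} p≋q = coeffwise λ i →
    trans (coeff-deriv p i) (trans (*-congˡ (coeff-≈ p≋q (suc i))) (sym (coeff-deriv q i)))

  deriv-+P : ∀ p q → deriv (p +P q) ≋ (deriv p +P deriv q)
  deriv-+P p q = coeffwise λ i → begin
    coeff (deriv (p +P q)) i                         ≈⟨ coeff-deriv (p +P q) i ⟩
    ι (suc i) * coeff (p +P q) (suc i)               ≈⟨ *-congˡ (coeff-+P p q (suc i)) ⟩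
    ι (suc i) * (coeff p (suc i) + coeff q (suc i))  ≈⟨ distribˡ _ _ _ ⟩
    ι (suc i) * coeff p (suc i) + ι (suc i) * coeff q (suc i)
      ≈⟨ +-cong (coeff-deriv p i) (coeff-deriv q i) ⟨
    coeff (deriv p) i + coeff (deriv q) i            ≈⟨ coeff-+P (deriv p) (deriv q) i ⟨
    coeff (deriv p +P deriv q) i                     ∎
    where open ≈-Reasoning

  deriv-scale : ∀ b p → deriv (scale b p) ≋ scale b (deriv p)
  deriv-scale b p = coeffwise λ i → begin
    coeff (deriv (scale b p)) i             ≈⟨ coeff-deriv (scale b p) i ⟩
    ι (suc i) * coeff (scale b p) (suc i)   ≈⟨ *-congˡ (coeff-scale b p (suc i)) ⟩
    ι (suc i) * (b * coeff p (suc i))       ≈⟨ *-leftComm _ _ _ ⟩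
    b * (ι (suc i) * coeff p (suc i))       ≈⟨ *-congˡ (coeff-deriv p i) ⟨
    b * coeff (deriv p) i                   ≈⟨ coeff-scale b (deriv p) i ⟨
    coeff (scale b (deriv p)) i             ∎
    where open ≈-Reasoning

  -- Coefficientwise this is (1 + i)·pᵢ = pᵢ + i·pᵢ.
  deriv-∷ : ∀ a p → deriv (a ∷ p) ≋ (p +P (0# ∷ deriv p))
  deriv-∷ a p = coeffwise λ i → begin
    coeff (deriv (a ∷ p)) i               ≈⟨ coeff-deriv (a ∷ p) i ⟩
    (1# + ι i) * coeff p i                ≈⟨ distribʳ _ 1# (ι i) ⟩
    1# * coeff p i + ι i * coeff p i      ≈⟨ +-cong (sym (*-identityˡ _)) (coeff-x·deriv i) ⟨
    coeff p i + coeff (0# ∷ deriv p) i    ≈⟨ coeff-+P p (0# ∷ deriv p) i ⟨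
    coeff (p +P (0# ∷ deriv p)) i         ∎
    where
    open ≈-Reasoning
    coeff-x·deriv : ∀ i → coeff (0# ∷ deriv p) i ≈ ι i * coeff p i
    coeff-x·deriv zero    = sym (zeroˡ _)
    coeff-x·deriv (suc i) = coeff-deriv p i

  deriv-*P : ∀ p q → deriv (p *P q) ≋ ((deriv p *P q) +P (p *P deriv q))
  deriv-*P []      q = ≋-refl
  deriv-*P (a ∷ p) q = begin
    deriv (scale a q +P (0# ∷ (p *P q)))
      ≈⟨ deriv-+P (scale a q) (0# ∷ (p *P q)) ⟩
    deriv (scale a q) +P deriv (0# ∷ (p *P q))
      ≈⟨ +P-cong (deriv-scale a q) (deriv-∷ 0# (p *P q)) ⟩
    scale a q′ +P (pq +P (0# ∷ deriv pq))
      ≈⟨ +P-congˡ (scale a q′) (+P-congˡ pq (∷-cong refl (deriv-*P p q))) ⟩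
    scale a q′ +P (pq +P (0# ∷ ((p′ *P q) +P (p *P q′))))
      ≈⟨ +P-congˡ (scale a q′) (+P-congˡ pq (0∷-+P (p′ *P q) (p *P q′))) ⟩
    scale a q′ +P (pq +P ((0# ∷ (p′ *P q)) +P (0# ∷ (p *P q′))))
      ≈⟨ +P-leftComm (scale a q′) pq _ ⟩
    pq +P (scale a q′ +P ((0# ∷ (p′ *P q)) +P (0# ∷ (p *P q′))))
      ≈⟨ +P-congˡ pq (+P-leftComm (scale a q′) (0# ∷ (p′ *P q)) _) ⟩
    pq +P ((0# ∷ (p′ *P q)) +P (scale a q′ +P (0# ∷ (p *P q′))))
      ≈⟨ +P-assoc pq (0# ∷ (p′ *P q)) _ ⟨
    (pq +P (0# ∷ (p′ *P q))) +P ((a ∷ p) *P q′)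
      ≈⟨ +P-congʳ _ (+P-congˡ pq (0∷-*P p′ q)) ⟨
    (pq +P ((0# ∷ p′) *P q)) +P ((a ∷ p) *P q′)
      ≈⟨ +P-congʳ _ (*P-distribʳ p (0# ∷ p′) q) ⟨
    ((p +P (0# ∷ p′)) *P q) +P ((a ∷ p) *P q′)
      ≈⟨ +P-congʳ _ (*P-congˡ q (deriv-∷ a p)) ⟨
    (deriv (a ∷ p) *P q) +P ((a ∷ p) *P q′)
      ∎
    where
    open ≋-Reasoning
    pq p′ q′ : Poly
    pq = p *P q
    p′ = deriv p
    q′ = deriv q

  deriv-∘P : ∀ p q → deriv (p ∘P q) ≋ (deriv q *P (deriv p ∘P q))
  deriv-∘P []      q = ≋-sym (*P-zeroʳ (deriv q))
  deriv-∘P (a ∷ p) q = begin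
    deriv ((a ∷ []) +P (q *P (p ∘P q)))
      ≈⟨ deriv-+P (a ∷ []) (q *P (p ∘P q)) ⟩
    deriv (q *P (p ∘P q))
      ≈⟨ deriv-*P q (p ∘P q) ⟩
    (q′ *P (p ∘P q)) +P (q *P deriv (p ∘P q))
      ≈⟨ +P-congˡ (q′ *P (p ∘P q)) (*P-congʳ q (deriv-∘P p q)) ⟩
    (q′ *P (p ∘P q)) +P (q *P (q′ *P (p′ ∘P q)))
      ≈⟨ +P-congˡ (q′ *P (p ∘P q)) (*P-leftComm q q′ (p′ ∘P q)) ⟩
    (q′ *P (p ∘P q)) +P (q′ *P (q *P (p′ ∘P q)))
      ≈⟨ *P-distribˡ q′ (p ∘P q) (q *P (p′ ∘P q)) ⟨
    q′ *P ((p ∘P q) +P (q *P (p′ ∘P q)))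
      ≈⟨ *P-congʳ q′ (+P-congˡ (p ∘P q) (∘P-0∷ p′ q)) ⟨
    q′ *P ((p ∘P q) +P ((0# ∷ p′) ∘P q))
      ≈⟨ *P-congʳ q′ (∘P-+P p (0# ∷ p′) q) ⟨
    q′ *P ((p +P (0# ∷ p′)) ∘P q)
      ≈⟨ *P-congʳ q′ (∘P-congˡ q (deriv-∷ a p)) ⟨
    q′ *P (deriv (a ∷ p) ∘P q)
      ∎
    where
    open ≋-Reasoning
    p′ q′ : Poly
    p′ = deriv p
    q′ = deriv q

  deriv^-∘P-linear : ∀ a b j f →
    deriv^ j (f ∘P (a ∷ b ∷ [])) ≋ scale (b ^ j) (deriv^ j f ∘P (a ∷ b ∷ []))
  deriv^-∘P-linear a b zero    f = ≋-sym (scale-identity _)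
  deriv^-∘P-linear a b (suc j) f = begin
    deriv (deriv^ j (f ∘P L))            ≈⟨ deriv-cong (deriv^-∘P-linear a b j f) ⟩
    deriv (scale (b ^ j) (g ∘P L))       ≈⟨ deriv-scale (b ^ j) (g ∘P L) ⟩
    scale (b ^ j) (deriv (g ∘P L))       ≈⟨ scale-cong refl (deriv-∘P g L) ⟩
    scale (b ^ j) (deriv L *P (deriv g ∘P L))
      ≈⟨ scale-cong refl (≋-trans (*P-congˡ _ deriv-L) (const-*P b _)) ⟩
    scale (b ^ j) (scale b (deriv g ∘P L))
      ≈⟨ scale-comm (b ^ j) b _ ⟩
    scale b (scale (b ^ j) (deriv g ∘P L))
      ≈⟨ scale-assoc b (b ^ j) _ ⟨
    scale (b ^ suc j) (deriv g ∘P L)     ∎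
    where
    open ≋-Reasoning
    L g : Poly
    L = a ∷ b ∷ []
    g = deriv^ j f
    deriv-L : deriv L ≋ (b ∷ [])
    deriv-L = ∷-cong (trans (*-congʳ (+-identityʳ 1#)) (*-identityˡ b)) ≋-refl

module AffineSubstitution {c ℓ} (F : Field c ℓ) where
  open Field F hiding (zero; inverse)
  open FieldDefs F
  open PolynomialArithmetic F
  open import Algebra.Properties.Semiring.Exp semiring using (_^_)
  open import Algebra.Properties.Ring ring
    using (-‿distribʳ-*; -‿anti-homo-+; //-rightDividesˡ; \\-leftDividesʳ; x∙y⁻¹≈ε⇒x≈y)

  IsUnit : Carrier → Set (c ⊔ ℓ)
  IsUnit u = ∃ λ v → v * u ≈ 1#

  nonzero⇒unit : ∀ {u} → ¬ u ≈ 0# → IsUnit u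
  nonzero⇒unit {u} u≉0 with Field.inverse F u u≉0
  ... | v , uv≈1 = v , trans (*-comm v u) uv≈1

  unit-* : ∀ {u w} → IsUnit u → IsUnit w → IsUnit (u * w)
  unit-* {u} {w} (u⁻¹ , u⁻¹u≈1) (w⁻¹ , w⁻¹w≈1) = w⁻¹ * u⁻¹ , (begin
    (w⁻¹ * u⁻¹) * (u * w)  ≈⟨ *-assoc w⁻¹ u⁻¹ (u * w) ⟩
    w⁻¹ * (u⁻¹ * (u * w))  ≈⟨ *-congˡ (*-assoc u⁻¹ u w) ⟨
    w⁻¹ * ((u⁻¹ * u) * w)  ≈⟨ *-congˡ (*-congʳ u⁻¹u≈1) ⟩
    w⁻¹ * (1# * w)         ≈⟨ *-congˡ (*-identityˡ w) ⟩
    w⁻¹ * w                ≈⟨ w⁻¹w≈1 ⟩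
    1#                     ∎)
    where open ≈-Reasoning

  unit-^ : ∀ {u} → IsUnit u → ∀ k → IsUnit (u ^ k)
  unit-^ _      zero    = 1# , *-identityˡ 1#
  unit-^ unit-u (suc k) = unit-* unit-u (unit-^ unit-u k)

  unit-*-cancel : ∀ {u x} → IsUnit u → u * x ≈ 0# → x ≈ 0#
  unit-*-cancel {u} {x} (v , vu≈1) ux≈0 = begin
    x             ≈⟨ *-identityˡ x ⟨
    1# * x        ≈⟨ *-congʳ vu≈1 ⟨
    (v * u) * x   ≈⟨ *-assoc v u x ⟩
    v * (u * x)   ≈⟨ *-congˡ ux≈0 ⟩
    v * 0#        ≈⟨ zeroʳ v ⟩
    0#            ∎
    where open ≈-Reasoning

  factorisation : ∀ k λ₀ g (∣g : Divides k λ₀ g) → g ≋ (((X- λ₀) ^P k) *P proj₁ ∣g)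
  factorisation k λ₀ g (q , g≈) = coeffwise g≈

  Divides-≋ : ∀ k λ₀ {g h} → g ≋ h → Divides k λ₀ g → Divides k λ₀ h
  Divides-≋ k λ₀ {g} g≋h ∣g = proj₁ ∣g , coeff-≈ (≋-trans (≋-sym g≋h) (factorisation k λ₀ g ∣g))

  Divides-scale : ∀ k λ₀ g u → Divides k λ₀ g → Divides k λ₀ (scale u g)
  Divides-scale k λ₀ g u ∣g = scale u (proj₁ ∣g) , coeff-≈
    (≋-trans (scale-cong refl (factorisation k λ₀ g ∣g)) (scale-*Pʳ u ((X- λ₀) ^P k) (proj₁ ∣g)))

  Divides-unscale : ∀ k λ₀ g {u} → IsUnit u → Divides k λ₀ (scale u g) → Divides k λ₀ g
  Divides-unscale k λ₀ g {u} (v , vu≈1) ∣ug = Divides-≋ k λ₀ v·u·g≋g (Divides-scale k λ₀ (scale u g) v ∣ug)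
    where
    v·u·g≋g : scale v (scale u g) ≋ g
    v·u·g≋g = ≋-trans (≋-sym (scale-assoc v u g)) (≋-trans (scale-cong vu≈1 ≋-refl) (scale-identity g))

  -- If substituting q turns x − λ into b·(x − μ), it turns (x − λ)ᵏ·h into (x − μ)ᵏ·bᵏ·h(q).
  Divides-∘P : ∀ k {λ₀ μ b} q → ((X- λ₀) ∘P q) ≋ scale b (X- μ) →
               ∀ g → Divides k λ₀ g → Divides k μ (g ∘P q)
  Divides-∘P k {λ₀} {μ} {b} q X-λ∘q≋b·X-μ g ∣g@(h , _) = scale (b ^ k) (h ∘P q) , coeff-≈ (begin
    g ∘P q                                         ≈⟨ ∘P-congˡ q (factorisation k λ₀ g ∣g) ⟩
    (((X- λ₀) ^P k) *P h) ∘P q                     ≈⟨ ∘P-*P ((X- λ₀) ^P k) h q ⟩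
    (((X- λ₀) ^P k) ∘P q) *P (h ∘P q)              ≈⟨ *P-congˡ (h ∘P q) (∘P-^P (X- λ₀) k q) ⟩
    (((X- λ₀) ∘P q) ^P k) *P (h ∘P q)              ≈⟨ *P-congˡ (h ∘P q) (^P-cong k X-λ∘q≋b·X-μ) ⟩
    (scale b (X- μ) ^P k) *P (h ∘P q)              ≈⟨ *P-congˡ (h ∘P q) (scale-^P b (X- μ) k) ⟩
    scale (b ^ k) ((X- μ) ^P k) *P (h ∘P q)        ≈⟨ scale-*Pˡ (b ^ k) ((X- μ) ^P k) (h ∘P q) ⟨
    scale (b ^ k) (((X- μ) ^P k) *P (h ∘P q))      ≈⟨ scale-*Pʳ (b ^ k) ((X- μ) ^P k) (h ∘P q) ⟩
    ((X- μ) ^P k) *P scale (b ^ k) (h ∘P q)        ∎)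
    where open ≋-Reasoning

  record Affine : Set (c ⊔ ℓ) where
    constructor affine
    field
      shift slope : Carrier
      slope-unit  : IsUnit slope

    poly : Poly
    poly = shift ∷ slope ∷ []

    apply : Carrier → Carrier
    apply x = shift + slope * x

  open Affine public

  inverse : Affine → Affine
  inverse (affine a b (b⁻¹ , b⁻¹b≈1)) = affine (- (b⁻¹ * a)) b⁻¹ (b , trans (*-comm b b⁻¹) b⁻¹b≈1)

  apply-cong : ∀ σ {x y} → x ≈ y → apply σ x ≈ apply σ y
  apply-cong σ x≈y = +-congˡ (*-congˡ x≈y)

  apply-inverse : ∀ σ x → apply (inverse σ) (apply σ x) ≈ x
  apply-inverse (affine a b (b⁻¹ , b⁻¹b≈1)) x = begin
    - (b⁻¹ * a) + b⁻¹ * (a + b * x)         ≈⟨ +-congˡ (distribˡ b⁻¹ a (b * x)) ⟩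
    - (b⁻¹ * a) + (b⁻¹ * a + b⁻¹ * (b * x)) ≈⟨ \\-leftDividesʳ (b⁻¹ * a) _ ⟩
    b⁻¹ * (b * x)                           ≈⟨ *-assoc b⁻¹ b x ⟨
    (b⁻¹ * b) * x                           ≈⟨ *-congʳ b⁻¹b≈1 ⟩
    1# * x                                  ≈⟨ *-identityˡ x ⟩
    x                                       ∎
    where open ≈-Reasoning

  poly-∘P-inverse : ∀ σ → (poly σ ∘P poly (inverse σ)) ≋ X
  poly-∘P-inverse (affine a b (b⁻¹ , b⁻¹b≈1)) =
    ≋-trans (linear-∘P a b (- (b⁻¹ * a) ∷ b⁻¹ ∷ [])) (∷-cong cancel-shift (∷-cong bb⁻¹≈1 ≋-refl))
    where
    open ≈-Reasoning
    bb⁻¹≈1 : b * b⁻¹ ≈ 1#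
    bb⁻¹≈1 = trans (*-comm b b⁻¹) b⁻¹b≈1
    cancel-shift : a + b * - (b⁻¹ * a) ≈ 0#
    cancel-shift = begin
      a + b * - (b⁻¹ * a)   ≈⟨ +-congˡ (-‿distribʳ-* b (b⁻¹ * a)) ⟨
      a + - (b * (b⁻¹ * a)) ≈⟨ +-congˡ (-‿cong (*-assoc b b⁻¹ a)) ⟨
      a + - ((b * b⁻¹) * a) ≈⟨ +-congˡ (-‿cong (trans (*-congʳ bb⁻¹≈1) (*-identityˡ a))) ⟩
      a + - a               ≈⟨ -‿inverseʳ a ⟩
      0#                    ∎

  ∘P-inverse : ∀ σ g → ((g ∘P poly σ) ∘P poly (inverse σ)) ≋ g
  ∘P-inverse σ g = ≋-trans (∘P-assoc g (poly σ) (poly (inverse σ)))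
    (≋-trans (∘P-congʳ g (poly-∘P-inverse σ)) (∘P-X g))

  X-∘P-affine : ∀ σ {λ₀ μ} → λ₀ ≈ apply σ μ → ((X- λ₀) ∘P poly σ) ≋ scale (slope σ) (X- μ)
  X-∘P-affine (affine a b _) {λ₀} {μ} λ₀≈a+bμ =
    ≋-trans (linear-∘P (- λ₀) 1# (a ∷ b ∷ [])) (∷-cong shift-term (∷-cong (*-comm 1# b) ≋-refl))
    where
    open ≈-Reasoning
    shift-term : - λ₀ + 1# * a ≈ b * - μ
    shift-term = begin
      - λ₀ + 1# * a              ≈⟨ +-cong (-‿cong λ₀≈a+bμ) (*-identityˡ a) ⟩
      - (a + b * μ) + a          ≈⟨ +-congʳ (-‿anti-homo-+ a (b * μ)) ⟩
      (- (b * μ) + - a) + a      ≈⟨ //-rightDividesˡ a (- (b * μ)) ⟩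
      - (b * μ)                  ≈⟨ -‿distribʳ-* b μ ⟩
      b * - μ                    ∎

  Multiplicity-≋ : ∀ {g h} λ₀ k → g ≋ h → Multiplicity g λ₀ k → Multiplicity h λ₀ k
  Multiplicity-≋ λ₀ k g≋h (∣g , ∤g) =
    Divides-≋ k λ₀ g≋h ∣g , λ ∣h → ∤g (Divides-≋ (suc k) λ₀ (≋-sym g≋h) ∣h)

  Multiplicity-scale : ∀ {u} g λ₀ k → IsUnit u → Multiplicity g λ₀ k → Multiplicity (scale u g) λ₀ k
  Multiplicity-scale {u} g λ₀ k unit-u (∣g , ∤g) =
    Divides-scale k λ₀ g u ∣g , λ ∣ug → ∤g (Divides-unscale (suc k) λ₀ g unit-u ∣ug)

  Multiplicity-∘P : ∀ σ g {λ₀ μ} k → λ₀ ≈ apply σ μ → Multiplicity g λ₀ k → Multiplicity (g ∘P poly σ) μ k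
  Multiplicity-∘P σ g {λ₀} {μ} k λ₀≈σμ (∣g , ∤g) =
    Divides-∘P k (poly σ) (X-∘P-affine σ λ₀≈σμ) g ∣g , λ ∣g∘σ →
    ∤g (Divides-≋ (suc k) λ₀ (∘P-inverse σ g)
         (Divides-∘P (suc k) (poly (inverse σ)) (X-∘P-affine (inverse σ) μ≈σ⁻¹λ₀) (g ∘P poly σ) ∣g∘σ))
    where
    μ≈σ⁻¹λ₀ : μ ≈ apply (inverse σ) λ₀
    μ≈σ⁻¹λ₀ = sym (trans (apply-cong (inverse σ) λ₀≈σμ) (apply-inverse σ μ))

  Bounded : ℕ → Poly → Set ℓ
  Bounded n p = ∀ i → n < i → coeff p i ≈ 0#

  coeff-∘P-linear : ∀ a b c p i →
    coeff ((c ∷ p) ∘P (a ∷ b ∷ [])) (suc i) ≈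
      a * coeff (p ∘P (a ∷ b ∷ [])) (suc i) + b * coeff (p ∘P (a ∷ b ∷ [])) i
  coeff-∘P-linear a b c p i = begin
    coeff ((c ∷ []) +P (L *P r)) (suc i)                  ≈⟨ coeff-+P (c ∷ []) (L *P r) (suc i) ⟩
    0# + coeff (scale a r +P (0# ∷ ((b ∷ []) *P r))) (suc i)
      ≈⟨ +-identityˡ _ ⟩
    coeff (scale a r +P (0# ∷ ((b ∷ []) *P r))) (suc i)   ≈⟨ coeff-+P (scale a r) _ (suc i) ⟩
    coeff (scale a r) (suc i) + coeff ((b ∷ []) *P r) i
      ≈⟨ +-cong (coeff-scale a r (suc i)) (coeff-≈ (const-*P b r) i) ⟩
    a * coeff r (suc i) + coeff (scale b r) i             ≈⟨ +-congˡ (coeff-scale b r i) ⟩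
    a * coeff r (suc i) + b * coeff r i                   ∎
    where
    open ≈-Reasoning
    L r : Poly
    L = a ∷ b ∷ []
    r = p ∘P L

  ∘P-linear-bounded : ∀ a b n p → Bounded n p →
    Bounded n (p ∘P (a ∷ b ∷ [])) × coeff (p ∘P (a ∷ b ∷ [])) n ≈ b ^ n * coeff p n
  ∘P-linear-bounded a b n       []      _       = (λ _ _ → refl) , sym (zeroʳ _)
  ∘P-linear-bounded a b zero    (c ∷ p) bounded = bounded′ , trans (coeff-≈ c∷p∘L≋c zero) (sym (*-identityˡ c))
    where
    p≋[] : p ≋ []
    p≋[] = coeffwise λ i → bounded (suc i) (s≤s z≤n)
    c∷p∘L≋c : ((c ∷ p) ∘P (a ∷ b ∷ [])) ≋ (c ∷ [])
    c∷p∘L≋c = ≋-trans (∘P-congˡ (a ∷ b ∷ []) (∷-cong refl p≋[]))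
                      (∘P-const c (a ∷ b ∷ []))
    bounded′ : Bounded zero ((c ∷ p) ∘P (a ∷ b ∷ []))
    bounded′ (suc i) _ = coeff-≈ c∷p∘L≋c (suc i)
  ∘P-linear-bounded a b (suc n) (c ∷ p) bounded = bounded′ , leading
    where
    L : Poly
    L = a ∷ b ∷ []
    IH : Bounded n (p ∘P L) × coeff (p ∘P L) n ≈ b ^ n * coeff p n
    IH = ∘P-linear-bounded a b n p (λ i n<i → bounded (suc i) (s≤s n<i))
    a·0+b·0≈0 : ∀ {x y} → x ≈ 0# → y ≈ 0# → a * x + b * y ≈ 0#
    a·0+b·0≈0 x≈0 y≈0 =
      trans (+-cong (trans (*-congˡ x≈0) (zeroʳ a)) (trans (*-congˡ y≈0) (zeroʳ b))) (+-identityˡ 0#)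
    bounded′ : Bounded (suc n) ((c ∷ p) ∘P L)
    bounded′ (suc i) (s≤s n<i) =
      trans (coeff-∘P-linear a b c p i) (a·0+b·0≈0 (proj₁ IH (suc i) (ℕₚ.m<n⇒m<1+n n<i)) (proj₁ IH i n<i))
    leading : coeff ((c ∷ p) ∘P L) (suc n) ≈ b ^ suc n * coeff p n
    leading = begin
      coeff ((c ∷ p) ∘P L) (suc n)                        ≈⟨ coeff-∘P-linear a b c p n ⟩
      a * coeff (p ∘P L) (suc n) + b * coeff (p ∘P L) n
        ≈⟨ +-cong (trans (*-congˡ (proj₁ IH (suc n) (ℕₚ.n<1+n n))) (zeroʳ a)) (*-congˡ (proj₂ IH)) ⟩
      0# + b * (b ^ n * coeff p n)                        ≈⟨ +-identityˡ _ ⟩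
      b * (b ^ n * coeff p n)                             ≈⟨ *-assoc b (b ^ n) _ ⟨
      b ^ suc n * coeff p n                               ∎
      where open ≈-Reasoning

  HasDegree-∘P : ∀ σ f n → HasDegree f n → HasDegree (f ∘P poly σ) n
  HasDegree-∘P (affine a b unit-b) f n (leading≉0 , bounded) = leading′≉0 , proj₁ transported
    where
    transported : Bounded n (f ∘P (a ∷ b ∷ [])) × coeff (f ∘P (a ∷ b ∷ [])) n ≈ b ^ n * coeff f n
    transported = ∘P-linear-bounded a b n f bounded
    leading′≉0 : ¬ coeff (f ∘P (a ∷ b ∷ [])) n ≈ 0#
    leading′≉0 leading′≈0 =
      leading≉0 (unit-*-cancel (unit-^ unit-b n) (trans (sym (proj₂ transported)) leading′≈0))

  IsMultMatrixOf-∘P : ∀ {m n} σ {Λ Λ′ : Fin m → Carrier} {M : Fin m → Fin (suc n) → ℕ} →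
    (∀ i → Λ i ≈ apply σ (Λ′ i)) → ∀ f → IsMultMatrixOf f Λ M → IsMultMatrixOf (f ∘P poly σ) Λ′ M
  IsMultMatrixOf-∘P σ@(affine a b unit-b) {Λ′ = Λ′} {M} Λ≈σΛ′ f mult i j =
    Multiplicity-≋ (Λ′ i) (M i j) (≋-sym (deriv^-∘P-linear a b (toℕ j) f))
      (Multiplicity-scale (g ∘P poly σ) (Λ′ i) (M i j) (unit-^ unit-b (toℕ j))
        (Multiplicity-∘P σ g (M i j) (Λ≈σΛ′ i) (mult i j)))
    where
    g : Poly
    g = deriv^ (toℕ j) f

  Realisable : ∀ {m} n → (Fin m → Carrier) → (Fin m → Fin (suc n) → ℕ) → Set (c ⊔ ℓ)
  Realisable n Λ M = ∃ λ f → HasDegree f n × IsMultMatrixOf f Λ M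

  Realisable-∘P : ∀ {m n} σ {Λ Λ′ : Fin m → Carrier} {M : Fin m → Fin (suc n) → ℕ} →
    (∀ i → Λ i ≈ apply σ (Λ′ i)) → Realisable n Λ M → Realisable n Λ′ M
  Realisable-∘P {n = n} σ {M = M} Λ≈σΛ′ (f , degree , mult) =
    f ∘P poly σ , HasDegree-∘P σ f n degree , IsMultMatrixOf-∘P σ {M = M} Λ≈σΛ′ f mult

  Realisable-affine-invariant : ∀ {m n} σ {Λ Λ′ : Fin m → Carrier} {M : Fin m → Fin (suc n) → ℕ} →
    (∀ i → Λ i ≈ apply σ (Λ′ i)) → Realisable n Λ′ M ⇔ Realisable n Λ M
  Realisable-affine-invariant σ {Λ} {Λ′} {M} Λ≈σΛ′ =
    mk⇔ (Realisable-∘P (inverse σ) {M = M} Λ′≈σ⁻¹Λ) (Realisable-∘P σ {M = M} Λ≈σΛ′)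
    where
    Λ′≈σ⁻¹Λ : ∀ i → Λ′ i ≈ apply (inverse σ) (Λ i)
    Λ′≈σ⁻¹Λ i = sym (trans (apply-cong (inverse σ) (Λ≈σΛ′ i)) (apply-inverse σ (Λ′ i)))

  affine-through : ∀ {λ₁ λ₂} → ¬ λ₁ ≈ λ₂ → Σ Affine λ σ → λ₁ ≈ apply σ 0# × λ₂ ≈ apply σ 1#
  affine-through {λ₁} {λ₂} λ₁≉λ₂ = affine λ₁ d (nonzero⇒unit d≉0) , sends-0 , sends-1
    where
    open ≈-Reasoning
    d : Carrier
    d = λ₂ + - λ₁
    d≉0 : ¬ d ≈ 0#
    d≉0 d≈0 = λ₁≉λ₂ (sym (x∙y⁻¹≈ε⇒x≈y λ₂ λ₁ d≈0))
    sends-0 : λ₁ ≈ λ₁ + d * 0#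
    sends-0 = sym (trans (+-congˡ (zeroʳ d)) (+-identityʳ λ₁))
    sends-1 : λ₂ ≈ λ₁ + d * 1#
    sends-1 = sym (begin
      λ₁ + d * 1#          ≈⟨ +-congˡ (*-identityʳ d) ⟩
      λ₁ + (λ₂ + - λ₁)     ≈⟨ +-comm λ₁ d ⟩
      (λ₂ + - λ₁) + λ₁     ≈⟨ //-rightDividesˡ λ₁ λ₂ ⟩
      λ₂                   ∎)

corollary1 : ∀ {c ℓ} (F : Field c ℓ) → let open FieldDefs F in
    CharZero → (n : ℕ) → (M : Fin 2 → Fin (suc n) → ℕ) → IsMultiplicityMatrix n M →
    (λ₁ λ₂ : Field.Carrier F) → ¬ (Field._≈_ F λ₁ λ₂) →
    (∃ λ f₀ → HasDegree f₀ n × IsMultMatrixOf f₀ (pair (Field.0# F) (Field.1# F)) M)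
    ⇔ (∃ λ f → HasDegree f n × IsMultMatrixOf f (pair λ₁ λ₂) M)
corollary1 F _ n M _ λ₁ λ₂ λ₁≉λ₂ = Realisable-affine-invariant σ {M = M} σ-moves-0,1
  where
  open AffineSubstitution F
  open Field F using (0#; 1#; _≈_)
  open FieldDefs F using (pair)
  through : Σ Affine λ σ → λ₁ ≈ apply σ 0# × λ₂ ≈ apply σ 1#
  through = affine-through λ₁≉λ₂
  σ : Affine
  σ = proj₁ through
  σ-moves-0,1 : ∀ i → pair λ₁ λ₂ i ≈ apply σ (pair 0# 1# i)
  σ-moves-0,1 zero       = proj₁ (proj₂ through)
  σ-moves-0,1 (suc zero) = proj₂ (proj₂ through)
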